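{- Let $F=k(\alpha)\subset k^s$ be a quadratic field extension of $k$ with $\mathrm{Gal}(F/k)$ generated by $\nu$, and let $$g_\alpha=\left(\begin{pmatrix}1&0&0\\0&1&1\\0&\alpha&\alpha^\nu\end{pmatrix},\ \frac{1}{\alpha-\alpha^\nu}\begin{pmatrix}1&0\\\alpha^\nu&\alpha^\nu-\alpha\end{pmatrix}\right)\in G(F).$$ Then for all $b_1\in\mathcal B^\times$, $b_2\in\mathcal B_F^\times$ and $t\in k^\times$, the element $g_\alpha\,\mathsf d(b_1,b_2,b_2^\nu,t)\,g_\alpha^{ -1}$ lies in $G(k)$.
   Context: Let $k$ be a field with separable closure $k^s$, $\mathcal B$ a quaternion algebra over $k$, $\mathcal B_F=\mathcal B\otimes_kF$, with $\nu$ acting on $\mathcal B_F$ through the second factor. $G=\mathrm{GL}_3(\mathcal B)\times\mathrm{GL}_2$ regarded as an algebraic group over $k$, so $G(F)=\mathrm{GL}_3(\mathcal B_F)\times\mathrm{GL}_2(F)$ and $G(k)$ is the subgroup of $\nu$-fixed elements. Notation: $\mathsf d(b_1,b_2,b_3,t)=\left(\mathrm{diag}(b_1,b_2,b_3),\ \mathrm{diag}(t,t)\right)$. -}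

module Defs where

open import Level using (Level; _⊔_) renaming (suc to lsuc)
open import Algebra.Bundles using (CommutativeRing; Ring)
open import Data.Fin using (Fin; zero; suc)
open import Data.Product using (_×_; _,_; ∃)
open import Data.Sum using (_⊎_)
open import Relation.Nullary using (¬_)

record Field (a ℓ : Level) : Set (lsuc (a ⊔ ℓ)) where
  field
    commutativeRing : CommutativeRing a ℓ
  open CommutativeRing commutativeRing public
  field
    0≉1     : ¬ (0# ≈ 1#)
    inverse : ∀ x → ¬ (x ≈ 0#) → ∃ λ y → (x * y) ≈ 1#

record KAlgebra {a ℓ : Level} (k : Field a ℓ) (b ℓ′ : Level)
       : Set (a ⊔ ℓ ⊔ lsuc (b ⊔ ℓ′)) where
  module K = Field k
  field
    ring : Ring b ℓ′
  open Ring ring public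
  field
    ι         : K.Carrier → Carrier
    ι-cong    : ∀ {x y} → x K.≈ y → ι x ≈ ι y
    ι-+       : ∀ x y → ι (x K.+ y) ≈ (ι x + ι y)
    ι-*       : ∀ x y → ι (x K.* y) ≈ (ι x * ι y)
    ι-1       : ι K.1# ≈ 1#
    ι-central : ∀ c x → (ι c * x) ≈ (x * ι c)

record IsTwoSidedIdeal {b ℓ′ p : Level} (R : Ring b ℓ′)
       (I : Ring.Carrier R → Set p) : Set (b ⊔ ℓ′ ⊔ p) where
  open Ring R hiding (zero)
  field
    resp  : ∀ {x y} → x ≈ y → I x → I y
    zero∈ : I 0#
    +∈    : ∀ {x y} → I x → I y → I (x + y)
    *ˡ∈   : ∀ r {x} → I x → I (r * x)
    *ʳ∈   : ∀ r {x} → I x → I (x * r)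

record IsQuaternionAlgebra {a ℓ b ℓ′ : Level} {k : Field a ℓ}
       (A : KAlgebra k b ℓ′) : Set (lsuc (a ⊔ ℓ ⊔ b ⊔ ℓ′)) where
  open KAlgebra A hiding (zero)
  lin : (Fin 4 → K.Carrier) → (Fin 4 → Carrier) → Carrier
  lin c e = ((ι (c zero) * e zero + ι (c (suc zero)) * e (suc zero))
            + ι (c (suc (suc zero))) * e (suc (suc zero)))
            + ι (c (suc (suc (suc zero)))) * e (suc (suc (suc zero)))
  field
    basis       : Fin 4 → Carrier
    spanning    : ∀ x → ∃ λ c → x ≈ lin c basis
    independent : ∀ c → lin c basis ≈ 0# → ∀ i → c i K.≈ K.0#
    central     : ∀ z → (∀ x → (z * x) ≈ (x * z)) → ∃ λ c → z ≈ ι c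
    simple      : (I : Carrier → Set (b ⊔ ℓ′)) → IsTwoSidedIdeal ring I →
                  (∀ x → I x → x ≈ 0#) ⊎ I 1#

-- The quadratic extension F = k(α), α a root of x² - s x + p
-- (s = α + α^ν, p = α α^ν), presented as F = k ⊕ k α, and
-- B_F = B ⊗_k F presented as B ⊕ B α (pairs (x , y) ↦ x ⊗ 1 + y ⊗ α).
-- ν acts on F and on the second tensor factor of B_F:
--   ν (x + y α) = x + y α^ν = (x + s y) - y α.

module Setup {a ℓ b ℓ′ : Level} {k : Field a ℓ} (A : KAlgebra k b ℓ′)
             (s p : Field.Carrier k) where
  open KAlgebra A hiding (zero)
  open K using () renaming (Carrier to k̂; _≈_ to _≈ₖ_; _+_ to _+ₖ_;
        _*_ to _*ₖ_; -_ to -ₖ_; 0# to 0ₖ; 1# to 1ₖ)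

  F : Set a
  F = k̂ × k̂

  _≈F_ : F → F → Set ℓ
  (x , y) ≈F (x′ , y′) = (x ≈ₖ x′) × (y ≈ₖ y′)

  _+F_ : F → F → F
  (x , y) +F (x′ , y′) = (x +ₖ x′) , (y +ₖ y′)

  -F_ : F → F
  -F (x , y) = (-ₖ x) , (-ₖ y)

  -- (x + yα)(x′ + y′α) with α² = s α - p
  _*F_ : F → F → F
  (x , y) *F (x′ , y′) =
    ((x *ₖ x′) +ₖ (-ₖ (p *ₖ (y *ₖ y′)))) ,
    (((x *ₖ y′) +ₖ (y *ₖ x′)) +ₖ (s *ₖ (y *ₖ y′)))

  0F 1F α αν : F
  0F = 0ₖ , 0ₖ
  1F = 1ₖ , 0ₖ
  α  = 0ₖ , 1ₖ
  αν = s , (-ₖ 1ₖ)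

  ofK : k̂ → F
  ofK t = t , 0ₖ

  νF : F → F
  νF (x , y) = (x +ₖ (s *ₖ y)) , (-ₖ y)

  BF : Set b
  BF = Carrier × Carrier

  _≈BF_ : BF → BF → Set ℓ′
  (x , y) ≈BF (x′ , y′) = (x ≈ x′) × (y ≈ y′)

  _+BF_ : BF → BF → BF
  (x , y) +BF (x′ , y′) = (x + x′) , (y + y′)

  _*BF_ : BF → BF → BF
  (x , y) *BF (x′ , y′) =
    ((x * x′) + (- (ι p * (y * y′)))) ,
    (((x * y′) + (y * x′)) + (ι s * (y * y′)))

  0BF 1BF : BF
  0BF = 0# , 0#
  1BF = 1# , 0#

  ofB : Carrier → BF
  ofB x = x , 0#

  ofF : F → BF
  ofF (x , y) = ι x , ι y

  νBF : BF → BF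
  νBF (x , y) = (x + (ι s * y)) , (- y)

  IsUnitB : Carrier → Set (b ⊔ ℓ′)
  IsUnitB x = ∃ λ y → ((x * y) ≈ 1#) × ((y * x) ≈ 1#)

  IsUnitBF : BF → Set (b ⊔ ℓ′)
  IsUnitBF x = ∃ λ y → ((x *BF y) ≈BF 1BF) × ((y *BF x) ≈BF 1BF)

  M3 : Set b
  M3 = Fin 3 → Fin 3 → BF

  M2 : Set a
  M2 = Fin 2 → Fin 2 → F

  _*M3_ : M3 → M3 → M3
  (X *M3 Y) i j = ((X i zero *BF Y zero j) +BF (X i (suc zero) *BF Y (suc zero) j))
                  +BF (X i (suc (suc zero)) *BF Y (suc (suc zero)) j)

  _*M2_ : M2 → M2 → M2
  (X *M2 Y) i j = (X i zero *F Y zero j) +F (X i (suc zero) *F Y (suc zero) j)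

  _≈M3_ : M3 → M3 → Set ℓ′
  X ≈M3 Y = ∀ i j → X i j ≈BF Y i j

  _≈M2_ : M2 → M2 → Set ℓ
  X ≈M2 Y = ∀ i j → X i j ≈F Y i j

  I3 : M3
  I3 zero zero = 1BF
  I3 (suc zero) (suc zero) = 1BF
  I3 (suc (suc zero)) (suc (suc zero)) = 1BF
  I3 _ _ = 0BF

  I2 : M2
  I2 zero zero = 1F
  I2 (suc zero) (suc zero) = 1F
  I2 _ _ = 0F

  diag3 : BF → BF → BF → M3
  diag3 x y z zero zero = x
  diag3 x y z (suc zero) (suc zero) = y
  diag3 x y z (suc (suc zero)) (suc (suc zero)) = z
  diag3 x y z _ _ = 0BF

  diag2 : F → F → M2
  diag2 x y zero zero = x
  diag2 x y (suc zero) (suc zero) = y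
  diag2 x y _ _ = 0F

  d : BF → BF → BF → F → M3 × M2
  d x y z t = diag3 x y z , diag2 t t

  gα₁ : M3
  gα₁ zero zero = 1BF
  gα₁ (suc zero) (suc zero) = 1BF
  gα₁ (suc zero) (suc (suc zero)) = 1BF
  gα₁ (suc (suc zero)) (suc zero) = ofF α
  gα₁ (suc (suc zero)) (suc (suc zero)) = ofF αν
  gα₁ _ _ = 0BF

  -- second component of g_α:  δ · [[1,0],[α^ν, α^ν - α]],
  -- where δ = 1/(α - α^ν) is supplied as an argument
  gα₂ : F → M2
  gα₂ δ zero zero = δ
  gα₂ δ zero (suc zero) = 0F
  gα₂ δ (suc zero) zero = δ *F αν
  gα₂ δ (suc zero) (suc zero) = δ *F (αν +F (-F α))

  InGk : M3 × M2 → Set (ℓ ⊔ ℓ′)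
  InGk (X , Y) = (∀ i j → νBF (X i j) ≈BF X i j) × (∀ i j → νF (Y i j) ≈F Y i j)

{-# OPTIONS --safe #-}
module Submission where

-- Write g for the GL₃ factor of g_α and D = diag(b₁, b₂, b₂^ν). As ν swaps α and α^ν,
-- ν(g) is g with its last two columns swapped, ν(D) is D with its last two diagonal
-- entries swapped, and ν(g⁻¹) is g⁻¹ with its last two rows swapped; hence
-- ν(g D g⁻¹) = g D g⁻¹. Concretely, any right inverse of g equals the explicit
-- gα₁⁻¹ δ, where δ = 1/(α - α^ν) satisfies ν(δ) = -δ, and
-- ν(g D gα₁⁻¹ δ) = g D gα₁⁻¹ (-ν δ) entry by entry. In the GL₂ factor, any conjugate of
-- diag(t, t) is t·1, which is ν-fixed as t ∈ k.

open import Defs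
open import Level using (Level)
open import Data.Product using (_×_; _,_; proj₁; proj₂)
open import Relation.Nullary using (¬_)

open import Algebra.Bundles using (CommutativeRing)
import Algebra.Solver.Ring
open import Algebra.Solver.Ring.AlmostCommutativeRing
  using (fromCommutativeRing; _-Raw-AlmostCommutative⟶_)
open import Data.Bool.Base using (Bool; true; false; T; _∧_; if_then_else_)
open import Data.Bool.Properties using (T-∧)
open import Data.Fin.Base using (Fin; zero; suc)
open import Data.Fin using (#_)
open import Data.Integer.Base as ℤ using (ℤ; +_; -[1+_])
import Data.Integer.Properties as ℤ
open import Data.Maybe.Base using (Maybe; is-just)
import Data.Maybe.Base as Maybe
open import Data.Maybe using (to-witness-T)
open import Data.Nat.Base as ℕ using (ℕ; zero; suc)
import Data.Nat.Properties as ℕ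
open import Data.Product.Relation.Binary.Pointwise.NonDependent using (×-setoid)
import Data.Sign.Base as Sign
open import Data.Vec.Base using (Vec; []; _∷_; lookup; map; zipWith; replicate; _[_]≔_)
open import Function.Base using (_∘_)
open import Function.Bundles using (Equivalence)
open import Relation.Binary.Bundles using (Setoid)
import Relation.Binary.PropositionalEquality as ≡
open import Relation.Nullary.Decidable using (dec⇒maybe)

-- Algebra.Solver.Ring needs a coefficient ring with decidable equality, so that cancellations
-- such as x - x = 0 are detected; ℤ maps into every commutative ring. The optimised
-- multiple _·_ makes fromℤ (+ 0) and fromℤ (+ 1) reduce to 0# and 1#.
module IntegerCoefficients {c ℓ : Level} (R : CommutativeRing c ℓ) where
  open CommutativeRing R
  open import Algebra.Properties.Ring ring
    using (-0#≈0#; -‿involutive; -‿+-comm; -‿distribˡ-*; -‿distribʳ-*)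
  open import Algebra.Properties.CommutativeSemigroup +-commutativeSemigroup
    using (x∙yz≈y∙xz)
  open import Algebra.Properties.Semiring.Mult.TCOptimised semiring
    using (1+×; ×-homo-+; ×1-homo-*) renaming (_×_ to _·_)
  open import Relation.Binary.Reasoning.Setoid setoid

  fromℤ : ℤ → Carrier
  fromℤ (+ n)    = n · 1#
  fromℤ -[1+ n ] = - (suc n · 1#)

  fromℤ[m⊖n]+n≈m : ∀ m n → fromℤ (m ℤ.⊖ n) + n · 1# ≈ m · 1#
  fromℤ[m⊖n]+n≈m zero    zero    = +-identityʳ 0#
  fromℤ[m⊖n]+n≈m zero    (suc n) = -‿inverseˡ (suc n · 1#)
  fromℤ[m⊖n]+n≈m (suc m) zero    = +-identityʳ (suc m · 1#)
  fromℤ[m⊖n]+n≈m (suc m) (suc n) rewrite ℤ.[1+m]⊖[1+n]≡m⊖n m n = begin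
    fromℤ (m ℤ.⊖ n) + suc n · 1#     ≈⟨ +-congˡ (1+× n 1#) ⟩
    fromℤ (m ℤ.⊖ n) + (1# + n · 1#)  ≈⟨ x∙yz≈y∙xz _ 1# _ ⟩
    1# + (fromℤ (m ℤ.⊖ n) + n · 1#)  ≈⟨ +-congˡ (fromℤ[m⊖n]+n≈m m n) ⟩
    1# + m · 1#                      ≈⟨ 1+× m 1# ⟨
    suc m · 1#                       ∎

  fromℤ-⊖ : ∀ m n → fromℤ (m ℤ.⊖ n) ≈ m · 1# - n · 1#
  fromℤ-⊖ m n = begin
    fromℤ (m ℤ.⊖ n)                      ≈⟨ +-identityʳ _ ⟨
    fromℤ (m ℤ.⊖ n) + 0#                 ≈⟨ +-congˡ (-‿inverseʳ (n · 1#)) ⟨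
    fromℤ (m ℤ.⊖ n) + (n · 1# - n · 1#)  ≈⟨ +-assoc _ _ _ ⟨
    (fromℤ (m ℤ.⊖ n) + n · 1#) - n · 1#  ≈⟨ +-congʳ (fromℤ[m⊖n]+n≈m m n) ⟩
    m · 1# - n · 1#                      ∎

  fromℤ-+ : ∀ i j → fromℤ (i ℤ.+ j) ≈ fromℤ i + fromℤ j
  fromℤ-+ (+ m)    (+ n)    = ×-homo-+ 1# m n
  fromℤ-+ (+ m)    -[1+ n ] = fromℤ-⊖ m (suc n)
  fromℤ-+ -[1+ m ] (+ n)    = trans (fromℤ-⊖ n (suc m)) (+-comm _ _)
  fromℤ-+ -[1+ m ] -[1+ n ] = begin
    - (suc (suc (m ℕ.+ n)) · 1#)     ≡⟨ ≡.cong (λ l → - (suc l · 1#)) (ℕ.+-suc m n) ⟨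
    - ((suc m ℕ.+ suc n) · 1#)       ≈⟨ -‿cong (×-homo-+ 1# (suc m) (suc n)) ⟩
    - (suc m · 1# + suc n · 1#)      ≈⟨ -‿+-comm _ _ ⟨
    - (suc m · 1#) + - (suc n · 1#)  ∎

  fromℤ-+◃ : ∀ n → fromℤ (Sign.+ ℤ.◃ n) ≈ n · 1#
  fromℤ-+◃ zero    = refl
  fromℤ-+◃ (suc n) = refl

  fromℤ--◃ : ∀ n → fromℤ (Sign.- ℤ.◃ n) ≈ - (n · 1#)
  fromℤ--◃ zero    = sym -0#≈0#
  fromℤ--◃ (suc n) = refl

  fromℤ-* : ∀ i j → fromℤ (i ℤ.* j) ≈ fromℤ i * fromℤ j
  fromℤ-* (+ m)    (+ n)    = trans (fromℤ-+◃ (m ℕ.* n)) (×1-homo-* m n)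
  fromℤ-* (+ m)    -[1+ n ] = begin
    fromℤ (Sign.- ℤ.◃ (m ℕ.* suc n))  ≈⟨ fromℤ--◃ (m ℕ.* suc n) ⟩
    - ((m ℕ.* suc n) · 1#)            ≈⟨ -‿cong (×1-homo-* m (suc n)) ⟩
    - (m · 1# * suc n · 1#)           ≈⟨ -‿distribʳ-* _ _ ⟩
    m · 1# * - (suc n · 1#)           ∎
  fromℤ-* -[1+ m ] (+ n)    = begin
    fromℤ (Sign.- ℤ.◃ (suc m ℕ.* n))  ≈⟨ fromℤ--◃ (suc m ℕ.* n) ⟩
    - ((suc m ℕ.* n) · 1#)            ≈⟨ -‿cong (×1-homo-* (suc m) n) ⟩
    - (suc m · 1# * n · 1#)           ≈⟨ -‿distribˡ-* _ _ ⟩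
    - (suc m · 1#) * n · 1#           ∎
  fromℤ-* -[1+ m ] -[1+ n ] = begin
    (suc m ℕ.* suc n) · 1#            ≈⟨ ×1-homo-* (suc m) (suc n) ⟩
    suc m · 1# * suc n · 1#           ≈⟨ -‿involutive _ ⟨
    - - (suc m · 1# * suc n · 1#)     ≈⟨ -‿cong (-‿distribʳ-* _ _) ⟩
    - (suc m · 1# * - (suc n · 1#))   ≈⟨ -‿distribˡ-* _ _ ⟩
    - (suc m · 1#) * - (suc n · 1#)   ∎

  fromℤ-- : ∀ i → fromℤ (ℤ.- i) ≈ - fromℤ i
  fromℤ-- (+ zero)  = sym -0#≈0#
  fromℤ-- (+ suc n) = refl
  fromℤ-- -[1+ n ]  = sym (-‿involutive _)

  fromℤ-homomorphism : ℤ.+-*-rawRing -Raw-AlmostCommutative⟶ fromCommutativeRing R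
  fromℤ-homomorphism = record
    { ⟦_⟧    = fromℤ
    ; +-homo = fromℤ-+
    ; *-homo = fromℤ-*
    ; -‿homo = fromℤ--
    ; 0-homo = refl
    ; 1-homo = refl
    }

  fromℤ-≟ : ∀ i j → Maybe (fromℤ i ≈ fromℤ j)
  fromℤ-≟ i j = Maybe.map (reflexive ∘ ≡.cong fromℤ) (dec⇒maybe (i ℤ.≟ j))

  private
    module Solver = Algebra.Solver.Ring ℤ.+-*-rawRing (fromCommutativeRing R) fromℤ-homomorphism fromℤ-≟
  open Solver public using (Polynomial; con; var; _:+_; _:*_; :-_; ⟦_⟧)
  open Solver using (normalise; _≟N_; ⟦_⟧↓; ⟦_⟧N-cong; correct)

  _≟ₚ_ : ∀ {m} → Polynomial m → Polynomial m → Bool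
  p ≟ₚ q = is-just (normalise p ≟N normalise q)

  ≟ₚ-sound : ∀ {m} (p q : Polynomial m) → T (p ≟ₚ q) → ∀ ρ → ⟦ p ⟧ ρ ≈ ⟦ q ⟧ ρ
  ≟ₚ-sound p q p≟q ρ = begin
    ⟦ p ⟧ ρ   ≈⟨ correct p ρ ⟨
    ⟦ p ⟧↓ ρ  ≈⟨ ⟦ to-witness-T _ p≟q ⟧N-cong ρ ⟩
    ⟦ q ⟧↓ ρ  ≈⟨ correct q ρ ⟩
    ⟦ q ⟧ ρ   ∎

module KAlgebraProperties {a ℓ b ℓ′ : Level} {k : Field a ℓ} (A : KAlgebra k b ℓ′) where
  open KAlgebra A hiding (zero)
  open import Algebra.Properties.Ring ring using (x+x≈x⇒x≈0; +-inverseˡ-unique)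

  ι-0 : ι K.0# ≈ 0#
  ι-0 = x+x≈x⇒x≈0 _ (trans (sym (ι-+ _ _)) (ι-cong (K.+-identityʳ K.0#)))

  ι-neg : ∀ x → ι (K.- x) ≈ - ι x
  ι-neg x = +-inverseˡ-unique _ _ (trans (sym (ι-+ _ _)) (trans (ι-cong (K.-‿inverseˡ x)) ι-0))

-- The algebra need not be commutative, but the identities needed here are k-linear in the
-- variables ranging over it: both sides are combinations Σ ι(cᵢ) vᵢ of 1# and the atoms vᵢ, with
-- coefficients cᵢ polynomial in scalar variables. Comparing the coefficients reduces such an
-- identity to the commutative solver over k.
module LinearNormalisation {a ℓ b ℓ′ : Level} {k : Field a ℓ} (A : KAlgebra k b ℓ′) where
  open KAlgebra A hiding (zero)
  open KAlgebraProperties A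
  open import Algebra.Properties.Ring ring using (-0#≈0#; -‿+-comm; -‿distribˡ-*)
  open import Algebra.Properties.CommutativeSemigroup +-commutativeSemigroup
    using (interchange)
  open import Relation.Binary.Reasoning.Setoid setoid
  open IntegerCoefficients K.commutativeRing public
    using (Polynomial; var; _:+_; _:*_; :-_; _≟ₚ_; ≟ₚ-sound)
    renaming (⟦_⟧ to ⟦_⟧ₚ)
  open IntegerCoefficients K.commutativeRing using (con)

  0ₚ 1ₚ : ∀ {m} → Polynomial m
  0ₚ = con (+ 0)
  1ₚ = con (+ 1)

  infixl 6 _⊕_
  infixl 7 _⊗_
  infix  8 ⊝_

  data Term (m n : ℕ) : Set where
    atom    : Fin n → Term m n
    scalar  : Polynomial m → Term m n
    0ᵗ 1ᵗ   : Term m n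
    _⊕_ _⊗_ : Term m n → Term m n → Term m n
    ⊝_      : Term m n → Term m n

  module _ {m n : ℕ} where

    isScalar : Term m n → Bool
    isScalar (atom _)   = false
    isScalar (scalar _) = true
    isScalar 0ᵗ         = true
    isScalar 1ᵗ         = true
    isScalar (x ⊕ y)    = isScalar x ∧ isScalar y
    isScalar (x ⊗ y)    = isScalar x ∧ isScalar y
    isScalar (⊝ x)      = isScalar x

    scalarPart : Term m n → Polynomial m
    scalarPart (atom _)   = 0ₚ
    scalarPart (scalar c) = c
    scalarPart 0ᵗ         = 0ₚ
    scalarPart 1ᵗ         = 1ₚ
    scalarPart (x ⊕ y)    = scalarPart x :+ scalarPart y
    scalarPart (x ⊗ y)    = scalarPart x :* scalarPart y
    scalarPart (⊝ x)      = :- scalarPart x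

    isLinear : Term m n → Bool
    isLinear (x ⊕ y) = isLinear x ∧ isLinear y
    isLinear (x ⊗ y) = if isScalar x then isLinear y else (isLinear x ∧ isScalar y)
    isLinear (⊝ x)   = isLinear x
    isLinear _       = true

    -- the coefficients of 1#, then those of the atoms
    normalForm : Term m n → Vec (Polynomial m) (suc n)
    normalForm (atom i)   = replicate _ 0ₚ [ suc i ]≔ 1ₚ
    normalForm (scalar c) = c ∷ replicate _ 0ₚ
    normalForm 0ᵗ         = normalForm (scalar 0ₚ)
    normalForm 1ᵗ         = normalForm (scalar 1ₚ)
    normalForm (x ⊕ y)    = zipWith _:+_ (normalForm x) (normalForm y)
    normalForm (x ⊗ y)    = if isScalar x then map (scalarPart x :*_) (normalForm y)
                                          else map (_:* scalarPart y) (normalForm x)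
    normalForm (⊝ x)      = map :-_ (normalForm x)

  _≟ᶜ_ : ∀ {m n} → Vec (Polynomial m) n → Vec (Polynomial m) n → Bool
  []       ≟ᶜ []       = true
  (c ∷ cs) ≟ᶜ (d ∷ ds) = (c ≟ₚ d) ∧ (cs ≟ᶜ ds)

  _≟_ : ∀ {m n} → Term m n → Term m n → Bool
  x ≟ y = isLinear x ∧ isLinear y ∧ (normalForm x ≟ᶜ normalForm y)

  module _ {m : ℕ} (ρ : Vec K.Carrier m) where

    ⟦_⟧ₖ : Polynomial m → Carrier
    ⟦ c ⟧ₖ = ι (⟦ c ⟧ₚ ρ)

    combination : ∀ {n} → Vec (Polynomial m) n → Vec Carrier n → Carrier
    combination []       []       = 0#
    combination (c ∷ cs) (v ∷ vs) = ⟦ c ⟧ₖ * v + combination cs vs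

    combination-0 : ∀ {n} (vs : Vec Carrier n) → combination (replicate n 0ₚ) vs ≈ 0#
    combination-0 []       = refl
    combination-0 (v ∷ vs) = begin
      ι K.0# * v + combination (replicate _ 0ₚ) vs
        ≈⟨ +-cong (trans (*-congʳ ι-0) (zeroˡ v)) (combination-0 vs) ⟩
      0# + 0#
        ≈⟨ +-identityʳ 0# ⟩
      0#
        ∎

    combination-unit : ∀ {n} (i : Fin n) vs → combination (replicate n 0ₚ [ i ]≔ 1ₚ) vs ≈ lookup vs i
    combination-unit zero    (v ∷ vs) = begin
      ι K.1# * v + combination (replicate _ 0ₚ) vs
        ≈⟨ +-cong (trans (*-congʳ ι-1) (*-identityˡ v)) (combination-0 vs) ⟩
      v + 0#
        ≈⟨ +-identityʳ v ⟩
      v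
        ∎
    combination-unit (suc i) (v ∷ vs) = begin
      ι K.0# * v + combination (replicate _ 0ₚ [ i ]≔ 1ₚ) vs
        ≈⟨ +-cong (trans (*-congʳ ι-0) (zeroˡ v)) (combination-unit i vs) ⟩
      0# + lookup vs i
        ≈⟨ +-identityˡ _ ⟩
      lookup vs i
        ∎

    combination-+ : ∀ {n} (cs ds : Vec (Polynomial m) n) vs →
                    combination (zipWith _:+_ cs ds) vs ≈ combination cs vs + combination ds vs
    combination-+ []       []       []       = sym (+-identityʳ 0#)
    combination-+ (c ∷ cs) (d ∷ ds) (v ∷ vs) = begin
      ι (⟦ c ⟧ₚ ρ K.+ ⟦ d ⟧ₚ ρ) * v + combination (zipWith _:+_ cs ds) vs
        ≈⟨ +-cong (trans (*-congʳ (ι-+ _ _)) (distribʳ v _ _)) (combination-+ cs ds vs) ⟩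
      (⟦ c ⟧ₖ * v + ⟦ d ⟧ₖ * v) + (combination cs vs + combination ds vs)
        ≈⟨ interchange _ _ _ _ ⟩
      (⟦ c ⟧ₖ * v + combination cs vs) + (⟦ d ⟧ₖ * v + combination ds vs)
        ∎

    combination-neg : ∀ {n} (cs : Vec (Polynomial m) n) vs →
                      combination (map :-_ cs) vs ≈ - combination cs vs
    combination-neg []       []       = sym -0#≈0#
    combination-neg (c ∷ cs) (v ∷ vs) = begin
      ι (K.- ⟦ c ⟧ₚ ρ) * v + combination (map :-_ cs) vs
        ≈⟨ +-cong (trans (*-congʳ (ι-neg _)) (sym (-‿distribˡ-* _ v))) (combination-neg cs vs) ⟩
      - (⟦ c ⟧ₖ * v) + - combination cs vs
        ≈⟨ -‿+-comm _ _ ⟩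
      - (⟦ c ⟧ₖ * v + combination cs vs)
        ∎

    combination-*ˡ : ∀ {n} d (cs : Vec (Polynomial m) n) vs →
                     combination (map (d :*_) cs) vs ≈ ⟦ d ⟧ₖ * combination cs vs
    combination-*ˡ d []       []       = sym (zeroʳ _)
    combination-*ˡ d (c ∷ cs) (v ∷ vs) = begin
      ι (⟦ d ⟧ₚ ρ K.* ⟦ c ⟧ₚ ρ) * v + combination (map (d :*_) cs) vs
        ≈⟨ +-cong (trans (*-congʳ (ι-* _ _)) (*-assoc _ _ v)) (combination-*ˡ d cs vs) ⟩
      ⟦ d ⟧ₖ * (⟦ c ⟧ₖ * v) + ⟦ d ⟧ₖ * combination cs vs
        ≈⟨ distribˡ _ _ _ ⟨
      ⟦ d ⟧ₖ * (⟦ c ⟧ₖ * v + combination cs vs)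
        ∎

    combination-*ʳ : ∀ {n} d (cs : Vec (Polynomial m) n) vs →
                     combination (map (_:* d) cs) vs ≈ combination cs vs * ⟦ d ⟧ₖ
    combination-*ʳ d []       []       = sym (zeroˡ _)
    combination-*ʳ d (c ∷ cs) (v ∷ vs) = begin
      ι (⟦ c ⟧ₚ ρ K.* ⟦ d ⟧ₚ ρ) * v + combination (map (_:* d) cs) vs
        ≈⟨ +-cong (*-congʳ (ι-* _ _)) (combination-*ʳ d cs vs) ⟩
      (⟦ c ⟧ₖ * ⟦ d ⟧ₖ) * v + combination cs vs * ⟦ d ⟧ₖ
        ≈⟨ +-congʳ (*-assoc _ _ _) ⟩
      ⟦ c ⟧ₖ * (⟦ d ⟧ₖ * v) + combination cs vs * ⟦ d ⟧ₖ
        ≈⟨ +-congʳ (*-congˡ (ι-central _ v)) ⟩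
      ⟦ c ⟧ₖ * (v * ⟦ d ⟧ₖ) + combination cs vs * ⟦ d ⟧ₖ
        ≈⟨ +-congʳ (*-assoc _ _ _) ⟨
      (⟦ c ⟧ₖ * v) * ⟦ d ⟧ₖ + combination cs vs * ⟦ d ⟧ₖ
        ≈⟨ distribʳ _ _ _ ⟨
      (⟦ c ⟧ₖ * v + combination cs vs) * ⟦ d ⟧ₖ
        ∎

    combination-cong : ∀ {n} (cs ds : Vec (Polynomial m) n) vs → T (cs ≟ᶜ ds) →
                       combination cs vs ≈ combination ds vs
    combination-cong []       []       []       _     = refl
    combination-cong (c ∷ cs) (d ∷ ds) (v ∷ vs) cs≟ds =
      +-cong (*-congʳ (ι-cong (≟ₚ-sound c d (proj₁ (Equivalence.to T-∧ cs≟ds)) ρ)))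
             (combination-cong cs ds vs (proj₂ (Equivalence.to T-∧ cs≟ds)))

    module _ {n : ℕ} (σ : Vec Carrier n) where

      ⟦_⟧ : Term m n → Carrier
      ⟦ atom i ⟧   = lookup σ i
      ⟦ scalar c ⟧ = ⟦ c ⟧ₖ
      ⟦ 0ᵗ ⟧       = 0#
      ⟦ 1ᵗ ⟧       = 1#
      ⟦ x ⊕ y ⟧    = ⟦ x ⟧ + ⟦ y ⟧
      ⟦ x ⊗ y ⟧    = ⟦ x ⟧ * ⟦ y ⟧
      ⟦ ⊝ x ⟧      = - ⟦ x ⟧

      ⟦⟧-scalar : ∀ x → T (isScalar x) → ⟦ x ⟧ ≈ ⟦ scalarPart x ⟧ₖ
      ⟦⟧-scalar (scalar c) _  = refl
      ⟦⟧-scalar 0ᵗ         _  = sym ι-0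
      ⟦⟧-scalar 1ᵗ         _  = sym ι-1
      ⟦⟧-scalar (x ⊕ y)    xy = trans (+-cong (⟦⟧-scalar x (proj₁ (Equivalence.to T-∧ xy)))
                                                (⟦⟧-scalar y (proj₂ (Equivalence.to T-∧ xy))))
                                       (sym (ι-+ _ _))
      ⟦⟧-scalar (x ⊗ y)    xy = trans (*-cong (⟦⟧-scalar x (proj₁ (Equivalence.to T-∧ xy)))
                                                (⟦⟧-scalar y (proj₂ (Equivalence.to T-∧ xy))))
                                       (sym (ι-* _ _))
      ⟦⟧-scalar (⊝ x)      x′ = trans (-‿cong (⟦⟧-scalar x x′)) (sym (ι-neg _))

      ⟦⟧-normalForm : ∀ x → T (isLinear x) → ⟦ x ⟧ ≈ combination (normalForm x) (1# ∷ σ)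
      ⟦⟧-normalForm (atom i)   _  = sym (combination-unit (suc i) (1# ∷ σ))
      ⟦⟧-normalForm (scalar c) _  = begin
        ⟦ c ⟧ₖ                                        ≈⟨ *-identityʳ _ ⟨
        ⟦ c ⟧ₖ * 1#                                   ≈⟨ +-identityʳ _ ⟨
        ⟦ c ⟧ₖ * 1# + 0#                              ≈⟨ +-congˡ (combination-0 σ) ⟨
        ⟦ c ⟧ₖ * 1# + combination (replicate _ 0ₚ) σ  ∎
      ⟦⟧-normalForm 0ᵗ         _  = trans (sym ι-0) (⟦⟧-normalForm (scalar 0ₚ) _)
      ⟦⟧-normalForm 1ᵗ         _  = trans (sym ι-1) (⟦⟧-normalForm (scalar 1ₚ) _)
      ⟦⟧-normalForm (x ⊕ y)    xy = begin
        ⟦ x ⟧ + ⟦ y ⟧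
          ≈⟨ +-cong (⟦⟧-normalForm x (proj₁ (Equivalence.to T-∧ xy)))
                    (⟦⟧-normalForm y (proj₂ (Equivalence.to T-∧ xy))) ⟩
        combination (normalForm x) (1# ∷ σ) + combination (normalForm y) (1# ∷ σ)
          ≈⟨ combination-+ (normalForm x) (normalForm y) _ ⟨
        combination (normalForm (x ⊕ y)) (1# ∷ σ)
          ∎
      ⟦⟧-normalForm (x ⊗ y)    xy with isScalar x in x-scalar
      ... | true  = begin
        ⟦ x ⟧ * ⟦ y ⟧
          ≈⟨ *-cong (⟦⟧-scalar x (≡.subst T (≡.sym x-scalar) _)) (⟦⟧-normalForm y xy) ⟩
        ⟦ scalarPart x ⟧ₖ * combination (normalForm y) (1# ∷ σ)
          ≈⟨ combination-*ˡ (scalarPart x) (normalForm y) _ ⟨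
        combination (map (scalarPart x :*_) (normalForm y)) (1# ∷ σ)
          ∎
      ... | false = begin
        ⟦ x ⟧ * ⟦ y ⟧
          ≈⟨ *-cong (⟦⟧-normalForm x (proj₁ (Equivalence.to T-∧ xy)))
                    (⟦⟧-scalar y (proj₂ (Equivalence.to T-∧ xy))) ⟩
        combination (normalForm x) (1# ∷ σ) * ⟦ scalarPart y ⟧ₖ
          ≈⟨ combination-*ʳ (scalarPart y) (normalForm x) _ ⟨
        combination (map (_:* scalarPart y) (normalForm x)) (1# ∷ σ)
          ∎
      ⟦⟧-normalForm (⊝ x)      x′ =
        trans (-‿cong (⟦⟧-normalForm x x′)) (sym (combination-neg (normalForm x) _))

      ≟-sound : ∀ x y → T (x ≟ y) → ⟦ x ⟧ ≈ ⟦ y ⟧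
      ≟-sound x y x≟y = begin
        ⟦ x ⟧
          ≈⟨ ⟦⟧-normalForm x (proj₁ x-linear,rest) ⟩
        combination (normalForm x) (1# ∷ σ)
          ≈⟨ combination-cong (normalForm x) (normalForm y) _ (proj₂ y-linear,same) ⟩
        combination (normalForm y) (1# ∷ σ)
          ≈⟨ ⟦⟧-normalForm y (proj₁ y-linear,same) ⟨
        ⟦ y ⟧
          ∎
        where
        x-linear,rest : T (isLinear x) × T (isLinear y ∧ (normalForm x ≟ᶜ normalForm y))
        x-linear,rest = Equivalence.to T-∧ x≟y
        y-linear,same : T (isLinear y) × T (normalForm x ≟ᶜ normalForm y)
        y-linear,same = Equivalence.to T-∧ (proj₂ x-linear,rest)

module Gα₁Inverse {a ℓ b ℓ′ : Level} {k : Field a ℓ} (A : KAlgebra k b ℓ′)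
                  (s p : Field.Carrier k) where
  open Setup A s p

  Inverts-α-αν : F → Set ℓ
  Inverts-α-αν δ = (δ *F (α +F (-F αν))) ≈F 1F

  -- if δ inverts α - α^ν, the inverse of [[1, 1], [α, α^ν]] is δ [[-α^ν, 1], [α, -1]]
  gα₁⁻¹ : F → M3
  gα₁⁻¹ δ zero             zero             = 1BF
  gα₁⁻¹ δ (suc zero)       (suc zero)       = ofF (δ *F (-F αν))
  gα₁⁻¹ δ (suc zero)       (suc (suc zero)) = ofF δ
  gα₁⁻¹ δ (suc (suc zero)) (suc zero)       = ofF (δ *F α)
  gα₁⁻¹ δ (suc (suc zero)) (suc (suc zero)) = ofF (-F δ)
  gα₁⁻¹ δ _                _                = 0BF

-- Syntactic copies of the operations of Setup, in the scalar variables s, p, ρ and the algebra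
-- variables σ. Evaluation sends each copy to the corresponding Setup expression by computation,
-- so proveF and proveBF establish identities stated with the operations of Setup themselves.
module SetupTerms {a ℓ b ℓ′ : Level} {k : Field a ℓ} (A : KAlgebra k b ℓ′) (s p : Field.Carrier k)
                  {m n : ℕ} (ρ : Vec (Field.Carrier k) m) (σ : Vec (KAlgebra.Carrier A) n) where
  open LinearNormalisation A
  private
    module K = Field k
    module S = Setup A s p

  Scalar : Set
  Scalar = Polynomial (suc (suc m))

  Element : Set
  Element = Term (suc (suc m)) n

  env : Vec K.Carrier (suc (suc m))
  env = s ∷ p ∷ ρ

  sᵗ pᵗ : Scalar
  sᵗ = var zero
  pᵗ = var (suc zero)

  κ : Fin m → Scalar
  κ i = var (suc (suc i))

  proveK : ∀ x y → {T (x ≟ₚ y)} → ⟦ x ⟧ₚ env K.≈ ⟦ y ⟧ₚ env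
  proveK x y {x≟y} = ≟ₚ-sound x y x≟y env

  infixl 6 _+F_ _+BF_
  infixl 7 _*F_ _*BF_ _*M3_ _*M2_
  infix  8 -F_

  F : Set
  F = Scalar × Scalar

  ⟦_⟧F : F → S.F
  ⟦ x , y ⟧F = ⟦ x ⟧ₚ env , ⟦ y ⟧ₚ env

  _+F_ _*F_ : F → F → F
  (x , y) +F (x′ , y′) = (x :+ x′) , (y :+ y′)
  (x , y) *F (x′ , y′) =
    ((x :* x′) :+ (:- (pᵗ :* (y :* y′)))) ,
    (((x :* y′) :+ (y :* x′)) :+ (sᵗ :* (y :* y′)))

  -F_ νF : F → F
  -F (x , y) = (:- x) , (:- y)
  νF (x , y) = (x :+ (sᵗ :* y)) , (:- y)

  0F 1F α αν : F
  0F = 0ₚ , 0ₚ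
  1F = 1ₚ , 0ₚ
  α  = 0ₚ , 1ₚ
  αν = sᵗ , (:- 1ₚ)

  ofK : Scalar → F
  ofK t = t , 0ₚ

  _≟F_ : F → F → Bool
  (x , y) ≟F (x′ , y′) = x ≟ₚ x′ ∧ y ≟ₚ y′

  proveF : ∀ u v → {T (u ≟F v)} → ⟦ u ⟧F S.≈F ⟦ v ⟧F
  proveF (x , y) (x′ , y′) {u≟v} =
    proveK x x′ {proj₁ (Equivalence.to (T-∧ {x ≟ₚ x′}) u≟v)} ,
    proveK y y′ {proj₂ (Equivalence.to (T-∧ {x ≟ₚ x′}) u≟v)}

  BF : Set
  BF = Element × Element

  ⟦_⟧BF : BF → S.BF
  ⟦ x , y ⟧BF = ⟦ env ⟧ σ x , ⟦ env ⟧ σ y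

  _+BF_ _*BF_ : BF → BF → BF
  (x , y) +BF (x′ , y′) = (x ⊕ x′) , (y ⊕ y′)
  (x , y) *BF (x′ , y′) =
    ((x ⊗ x′) ⊕ (⊝ (scalar pᵗ ⊗ (y ⊗ y′)))) ,
    (((x ⊗ y′) ⊕ (y ⊗ x′)) ⊕ (scalar sᵗ ⊗ (y ⊗ y′)))

  0BF 1BF : BF
  0BF = 0ᵗ , 0ᵗ
  1BF = 1ᵗ , 0ᵗ

  ofB : Element → BF
  ofB x = x , 0ᵗ

  ofF : F → BF
  ofF (x , y) = scalar x , scalar y

  νBF : BF → BF
  νBF (x , y) = (x ⊕ (scalar sᵗ ⊗ y)) , (⊝ y)

  _≟BF_ : BF → BF → Bool
  (x , y) ≟BF (x′ , y′) = x ≟ x′ ∧ y ≟ y′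

  proveBF : ∀ u v → {T (u ≟BF v)} → ⟦ u ⟧BF S.≈BF ⟦ v ⟧BF
  proveBF (x , y) (x′ , y′) {u≟v} =
    ≟-sound env σ x x′ (proj₁ (Equivalence.to (T-∧ {x ≟ x′}) u≟v)) ,
    ≟-sound env σ y y′ (proj₂ (Equivalence.to (T-∧ {x ≟ x′}) u≟v))

  M3 : Set
  M3 = Fin 3 → Fin 3 → BF

  _*M3_ : M3 → M3 → M3
  (X *M3 Y) i j = ((X i zero *BF Y zero j) +BF (X i (suc zero) *BF Y (suc zero) j))
                  +BF (X i (suc (suc zero)) *BF Y (suc (suc zero)) j)

  I3 : M3
  I3 zero             zero             = 1BF
  I3 (suc zero)       (suc zero)       = 1BF
  I3 (suc (suc zero)) (suc (suc zero)) = 1BF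
  I3 _                _                = 0BF

  diag3 : BF → BF → BF → M3
  diag3 x y z zero             zero             = x
  diag3 x y z (suc zero)       (suc zero)       = y
  diag3 x y z (suc (suc zero)) (suc (suc zero)) = z
  diag3 x y z _                _                = 0BF

  gα₁ : M3
  gα₁ zero             zero             = 1BF
  gα₁ (suc zero)       (suc zero)       = 1BF
  gα₁ (suc zero)       (suc (suc zero)) = 1BF
  gα₁ (suc (suc zero)) (suc zero)       = ofF α
  gα₁ (suc (suc zero)) (suc (suc zero)) = ofF αν
  gα₁ _                _                = 0BF

  gα₁⁻¹ : F → M3
  gα₁⁻¹ δ zero             zero             = 1BF
  gα₁⁻¹ δ (suc zero)       (suc zero)       = ofF (δ *F (-F αν))
  gα₁⁻¹ δ (suc zero)       (suc (suc zero)) = ofF δ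
  gα₁⁻¹ δ (suc (suc zero)) (suc zero)       = ofF (δ *F α)
  gα₁⁻¹ δ (suc (suc zero)) (suc (suc zero)) = ofF (-F δ)
  gα₁⁻¹ δ _                _                = 0BF

  M2 : Set
  M2 = Fin 2 → Fin 2 → F

  _*M2_ : M2 → M2 → M2
  (X *M2 Y) i j = (X i zero *F Y zero j) +F (X i (suc zero) *F Y (suc zero) j)

  I2 : M2
  I2 zero       zero       = 1F
  I2 (suc zero) (suc zero) = 1F
  I2 _          _          = 0F

  diag2 : F → F → M2
  diag2 x y zero       zero       = x
  diag2 x y (suc zero) (suc zero) = y
  diag2 x y _          _          = 0F

module GαConjugation {a ℓ b ℓ′ : Level} {k : Field a ℓ} (A : KAlgebra k b ℓ′)
                     (s p : Field.Carrier k) where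
  open KAlgebra A using (Carrier; setoid; +-cong; *-cong; -‿cong; ι-cong) renaming (refl to B-refl)
  open Setup A s p
  open Gα₁Inverse A s p
  open LinearNormalisation A using (atom; _:+_; _:*_; :-_; 0ₚ; ⟦_⟧ₚ)
  private
    module K = Field k

    F-setoid BF-setoid : Setoid _ _
    F-setoid  = ×-setoid K.setoid K.setoid
    BF-setoid = ×-setoid setoid setoid

    module ≈F  = Setoid F-setoid
    module ≈BF = Setoid BF-setoid

  -F-cong : ∀ {x y} → x ≈F y → (-F x) ≈F (-F y)
  -F-cong (x₀ , x₁) = K.-‿cong x₀ , K.-‿cong x₁

  *F-cong : ∀ {x x′ y y′} → x ≈F x′ → y ≈F y′ → (x *F y) ≈F (x′ *F y′)
  *F-cong (x₀ , x₁) (y₀ , y₁) =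
    K.+-cong (K.*-cong x₀ y₀) (K.-‿cong (K.*-cong K.refl (K.*-cong x₁ y₁))) ,
    K.+-cong (K.+-cong (K.*-cong x₀ y₁) (K.*-cong x₁ y₀)) (K.*-cong K.refl (K.*-cong x₁ y₁))

  νF-cong : ∀ {x y} → x ≈F y → νF x ≈F νF y
  νF-cong (x₀ , x₁) = K.+-cong x₀ (K.*-cong K.refl x₁) , K.-‿cong x₁

  +BF-cong : ∀ {x x′ y y′} → x ≈BF x′ → y ≈BF y′ → (x +BF y) ≈BF (x′ +BF y′)
  +BF-cong (x₀ , x₁) (y₀ , y₁) = +-cong x₀ y₀ , +-cong x₁ y₁

  *BF-cong : ∀ {x x′ y y′} → x ≈BF x′ → y ≈BF y′ → (x *BF y) ≈BF (x′ *BF y′)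
  *BF-cong (x₀ , x₁) (y₀ , y₁) =
    +-cong (*-cong x₀ y₀) (-‿cong (*-cong B-refl (*-cong x₁ y₁))) ,
    +-cong (+-cong (*-cong x₀ y₁) (*-cong x₁ y₀)) (*-cong B-refl (*-cong x₁ y₁))

  νBF-cong : ∀ {x y} → x ≈BF y → νBF x ≈BF νBF y
  νBF-cong (x₀ , x₁) = +-cong x₀ (*-cong B-refl x₁) , -‿cong x₁

  ofF-cong : ∀ {x y} → x ≈F y → ofF x ≈BF ofF y
  ofF-cong (x₀ , x₁) = ι-cong x₀ , ι-cong x₁

  *M3-congʳ : ∀ X {Y Y′} → Y ≈M3 Y′ → (X *M3 Y) ≈M3 (X *M3 Y′)
  *M3-congʳ X Y≈Y′ i j =
    +BF-cong (+BF-cong (*BF-cong ≈BF.refl (Y≈Y′ zero j)) (*BF-cong ≈BF.refl (Y≈Y′ (suc zero) j)))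
             (*BF-cong ≈BF.refl (Y≈Y′ (suc (suc zero)) j))

  gα₁⁻¹-cong : ∀ {δ δ′} → δ ≈F δ′ → gα₁⁻¹ δ ≈M3 gα₁⁻¹ δ′
  gα₁⁻¹-cong δ≈δ′ zero             zero             = ≈BF.refl
  gα₁⁻¹-cong δ≈δ′ zero             (suc zero)       = ≈BF.refl
  gα₁⁻¹-cong δ≈δ′ zero             (suc (suc zero)) = ≈BF.refl
  gα₁⁻¹-cong δ≈δ′ (suc zero)       zero             = ≈BF.refl
  gα₁⁻¹-cong δ≈δ′ (suc zero)       (suc zero)       = ofF-cong (*F-cong δ≈δ′ ≈F.refl)
  gα₁⁻¹-cong δ≈δ′ (suc zero)       (suc (suc zero)) = ofF-cong δ≈δ′
  gα₁⁻¹-cong δ≈δ′ (suc (suc zero)) zero             = ≈BF.refl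
  gα₁⁻¹-cong δ≈δ′ (suc (suc zero)) (suc zero)       = ofF-cong (*F-cong δ≈δ′ ≈F.refl)
  gα₁⁻¹-cong δ≈δ′ (suc (suc zero)) (suc (suc zero)) = ofF-cong (-F-cong δ≈δ′)

  ν-antiInvariant : ∀ δ → Inverts-α-αν δ → (-F (νF δ)) ≈F δ
  ν-antiInvariant δ (_ , αCoeff≈0) = first , Tm.proveK (:- (:- d₁)) d₁
    where
    module Tm = SetupTerms A s p (proj₁ δ ∷ proj₂ δ ∷ []) []
    open import Relation.Binary.Reasoning.Setoid K.setoid
    d₀ d₁ : Tm.Scalar
    d₀ = Tm.κ (# 0)
    d₁ = Tm.κ (# 1)
    -- δ + ν δ = (2 d₀ + s d₁, 0), and 2 d₀ + s d₁ is the α-coordinate of δ (α - α^ν) = 1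
    αCoeff : Tm.Scalar
    αCoeff = proj₂ ((d₀ , d₁) Tm.*F (Tm.α Tm.+F Tm.-F Tm.αν))
    first : (K.- (proj₁ δ K.+ (s K.* proj₂ δ))) K.≈ proj₁ δ
    first = begin
      K.- (proj₁ δ K.+ (s K.* proj₂ δ))  ≈⟨ Tm.proveK (:- (d₀ :+ Tm.sᵗ :* d₁)) (d₀ :+ :- αCoeff) ⟩
      proj₁ δ K.+ K.- ⟦ αCoeff ⟧ₚ Tm.env ≈⟨ K.+-congˡ (K.-‿cong αCoeff≈0) ⟩
      proj₁ δ K.+ K.- K.0#               ≈⟨ Tm.proveK (d₀ :+ :- 0ₚ) d₀ ⟩
      proj₁ δ                            ∎

  ofF-1F-identityˡ : ∀ x → (ofF 1F *BF x) ≈BF x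
  ofF-1F-identityˡ x = Tm.proveBF (Tm.ofF Tm.1F Tm.*BF X) X
    where
    module Tm = SetupTerms A s p [] (proj₁ x ∷ proj₂ x ∷ [])
    X : Tm.BF
    X = atom (# 0) , atom (# 1)

  coordinates : BF → BF → BF → Vec Carrier 6
  coordinates (x₀ , y₀) (x₁ , y₁) (x₂ , y₂) = x₀ ∷ y₀ ∷ x₁ ∷ y₁ ∷ x₂ ∷ y₂ ∷ []

  -- Entry (i, j) of X *M3 Y only involves row i of X and column j of Y, so a whole row or
  -- column can be normalised at once with its six coordinates as atoms.
  module ThreeAtoms {m : ℕ} (ρ : Vec K.Carrier m) (x₀ x₁ x₂ : BF) where
    open SetupTerms A s p ρ (coordinates x₀ x₁ x₂) public

    atoms : Fin 3 → SetupTerms.BF A s p ρ (coordinates x₀ x₁ x₂)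
    atoms zero             = atom (# 0) , atom (# 1)
    atoms (suc zero)       = atom (# 2) , atom (# 3)
    atoms (suc (suc zero)) = atom (# 4) , atom (# 5)

  *M3-identityʳ : ∀ X → (X *M3 I3) ≈M3 X
  *M3-identityʳ X i = column
    where
    module Tm = ThreeAtoms [] (X i zero) (X i (suc zero)) (X i (suc (suc zero)))
    rowᵢ : Tm.M3
    rowᵢ _ = Tm.atoms
    column : ∀ j → (X *M3 I3) i j ≈BF X i j
    column zero             = Tm.proveBF ((rowᵢ Tm.*M3 Tm.I3) i zero) (rowᵢ i zero)
    column (suc zero)       = Tm.proveBF ((rowᵢ Tm.*M3 Tm.I3) i (suc zero)) (rowᵢ i (suc zero))
    column (suc (suc zero)) = Tm.proveBF ((rowᵢ Tm.*M3 Tm.I3) i (suc (suc zero))) (rowᵢ i (suc (suc zero)))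

  gα₁⁻¹-inverseˡ : ∀ δ → Inverts-α-αν δ → ∀ H → (gα₁⁻¹ δ *M3 (gα₁ *M3 H)) ≈M3 H
  gα₁⁻¹-inverseˡ δ δ-inverts H i j = row i
    where
    module Tm = ThreeAtoms (proj₁ δ ∷ proj₂ δ ∷ []) (H zero j) (H (suc zero) j) (H (suc (suc zero)) j)
    Δ : Tm.F
    Δ = Tm.κ (# 0) , Tm.κ (# 1)
    columnⱼ : Tm.M3
    columnⱼ l _ = Tm.atoms l
    lhs : Fin 3 → Tm.BF
    lhs i = (Tm.gα₁⁻¹ Δ Tm.*M3 (Tm.gα₁ Tm.*M3 columnⱼ)) i j
    scaled : Fin 3 → Tm.BF
    scaled l = Tm.ofF (Δ Tm.*F (Tm.α Tm.+F Tm.-F Tm.αν)) Tm.*BF Tm.atoms l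
    cancel : ∀ x → (ofF (δ *F (α +F (-F αν))) *BF x) ≈BF x
    cancel x = ≈BF.trans (*BF-cong (ofF-cong δ-inverts) ≈BF.refl) (ofF-1F-identityˡ x)
    row : ∀ i → (gα₁⁻¹ δ *M3 (gα₁ *M3 H)) i j ≈BF H i j
    row zero             = Tm.proveBF (lhs zero) (Tm.atoms zero)
    row (suc zero)       = ≈BF.trans (Tm.proveBF (lhs (suc zero)) (scaled (suc zero))) (cancel _)
    row (suc (suc zero)) = ≈BF.trans (Tm.proveBF (lhs (suc (suc zero))) (scaled (suc (suc zero)))) (cancel _)

  rightInverse≈gα₁⁻¹ : ∀ δ → Inverts-α-αν δ → ∀ H → (gα₁ *M3 H) ≈M3 I3 → H ≈M3 gα₁⁻¹ δ
  rightInverse≈gα₁⁻¹ δ δ-inverts H gα₁H≈I i j = begin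
    H i j                          ≈⟨ gα₁⁻¹-inverseˡ δ δ-inverts H i j ⟨
    (gα₁⁻¹ δ *M3 (gα₁ *M3 H)) i j  ≈⟨ *M3-congʳ (gα₁⁻¹ δ) gα₁H≈I i j ⟩
    (gα₁⁻¹ δ *M3 I3) i j           ≈⟨ *M3-identityʳ (gα₁⁻¹ δ) i j ⟩
    gα₁⁻¹ δ i j                    ∎
    where open import Relation.Binary.Reasoning.Setoid BF-setoid

  conjugate : Carrier → BF → F → M3
  conjugate b₁ b₂ δ = (gα₁ *M3 diag3 (ofB b₁) b₂ (νBF b₂)) *M3 gα₁⁻¹ δ

  module _ (b₁ : Carrier) (b₂ : BF) (δ : F) where
    private
      module Tm = SetupTerms A s p (proj₁ δ ∷ proj₂ δ ∷ []) (b₁ ∷ proj₁ b₂ ∷ proj₂ b₂ ∷ [])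
      Δ : Tm.F
      Δ = Tm.κ (# 0) , Tm.κ (# 1)
      B₂ : Tm.BF
      B₂ = atom (# 1) , atom (# 2)
      conjugateᵗ : Tm.F → Tm.M3
      conjugateᵗ δ =
        (Tm.gα₁ Tm.*M3 Tm.diag3 (Tm.ofB (atom (# 0))) B₂ (Tm.νBF B₂)) Tm.*M3 Tm.gα₁⁻¹ δ
      lhs rhs : Fin 3 → Fin 3 → Tm.BF
      lhs i j = Tm.νBF (conjugateᵗ Δ i j)
      rhs i j = conjugateᵗ (Tm.-F (Tm.νF Δ)) i j
      entry : ∀ i j → {T (lhs i j Tm.≟BF rhs i j)} → Tm.⟦ lhs i j ⟧BF ≈BF Tm.⟦ rhs i j ⟧BF
      entry i j {ok} = Tm.proveBF (lhs i j) (rhs i j) {ok}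

    ν-conjugate : ∀ i j → νBF (conjugate b₁ b₂ δ i j) ≈BF conjugate b₁ b₂ (-F (νF δ)) i j
    ν-conjugate zero             zero             = entry zero zero
    ν-conjugate zero             (suc zero)       = entry zero (suc zero)
    ν-conjugate zero             (suc (suc zero)) = entry zero (suc (suc zero))
    ν-conjugate (suc zero)       zero             = entry (suc zero) zero
    ν-conjugate (suc zero)       (suc zero)       = entry (suc zero) (suc zero)
    ν-conjugate (suc zero)       (suc (suc zero)) = entry (suc zero) (suc (suc zero))
    ν-conjugate (suc (suc zero)) zero             = entry (suc (suc zero)) zero
    ν-conjugate (suc (suc zero)) (suc zero)       = entry (suc (suc zero)) (suc zero)
    ν-conjugate (suc (suc zero)) (suc (suc zero)) = entry (suc (suc zero)) (suc (suc zero))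

  gα₁-conjugate-νFixed : ∀ δ → Inverts-α-αν δ → ∀ h → (gα₁ *M3 h) ≈M3 I3 →
    ∀ b₁ b₂ i j → νBF (((gα₁ *M3 diag3 (ofB b₁) b₂ (νBF b₂)) *M3 h) i j)
                    ≈BF ((gα₁ *M3 diag3 (ofB b₁) b₂ (νBF b₂)) *M3 h) i j
  gα₁-conjugate-νFixed δ δ-inverts h gα₁h≈I b₁ b₂ i j = begin
    νBF (X i j)                      ≈⟨ νBF-cong (X≈conjugate i j) ⟩
    νBF (conjugate b₁ b₂ δ i j)      ≈⟨ ν-conjugate b₁ b₂ δ i j ⟩
    conjugate b₁ b₂ (-F (νF δ)) i j  ≈⟨ *M3-congʳ gα₁D (gα₁⁻¹-cong -νδ≈δ) i j ⟩
    conjugate b₁ b₂ δ i j            ≈⟨ X≈conjugate i j ⟨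
    X i j                            ∎
    where
    open import Relation.Binary.Reasoning.Setoid BF-setoid
    gα₁D X : M3
    gα₁D = gα₁ *M3 diag3 (ofB b₁) b₂ (νBF b₂)
    X    = gα₁D *M3 h
    X≈conjugate : X ≈M3 conjugate b₁ b₂ δ
    X≈conjugate = *M3-congʳ gα₁D (rightInverse≈gα₁⁻¹ δ δ-inverts h gα₁h≈I)
    -νδ≈δ : (-F (νF δ)) ≈F δ
    -νδ≈δ = ν-antiInvariant δ δ-inverts

  diag2-central : ∀ t g h → ((g *M2 diag2 (ofK t) (ofK t)) *M2 h) ≈M2 (λ i j → ofK t *F (g *M2 h) i j)
  diag2-central t g h i j = Tm.proveF (((G Tm.*M2 Tm.diag2 tᵗ tᵗ) Tm.*M2 H) i j) (tᵗ Tm.*F (G Tm.*M2 H) i j)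
    where
    module Tm = SetupTerms A s p
      (t ∷ proj₁ (g i zero) ∷ proj₂ (g i zero) ∷ proj₁ (g i (suc zero)) ∷ proj₂ (g i (suc zero))
         ∷ proj₁ (h zero j) ∷ proj₂ (h zero j) ∷ proj₁ (h (suc zero) j) ∷ proj₂ (h (suc zero) j) ∷ []) []
    tᵗ : Tm.F
    tᵗ = Tm.ofK (Tm.κ (# 0))
    -- every row of G is row i of g, every column of H is column j of h
    G H : Tm.M2
    G _ zero       = Tm.κ (# 1) , Tm.κ (# 2)
    G _ (suc zero) = Tm.κ (# 3) , Tm.κ (# 4)
    H zero       _ = Tm.κ (# 5) , Tm.κ (# 6)
    H (suc zero) _ = Tm.κ (# 7) , Tm.κ (# 8)

  module _ (t : K.Carrier) where
    private
      module Tm = SetupTerms A s p (t ∷ []) []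
      tI : Fin 2 → Fin 2 → Tm.F
      tI i j = Tm.ofK (Tm.κ (# 0)) Tm.*F Tm.I2 i j
      entry : ∀ i j → {T (Tm.νF (tI i j) Tm.≟F tI i j)} →
              Tm.⟦ Tm.νF (tI i j) ⟧F ≈F Tm.⟦ tI i j ⟧F
      entry i j {ok} = Tm.proveF (Tm.νF (tI i j)) (tI i j) {ok}

    scalarMatrix-νFixed : ∀ i j → νF (ofK t *F I2 i j) ≈F (ofK t *F I2 i j)
    scalarMatrix-νFixed zero       zero       = entry zero zero
    scalarMatrix-νFixed zero       (suc zero) = entry zero (suc zero)
    scalarMatrix-νFixed (suc zero) zero       = entry (suc zero) zero
    scalarMatrix-νFixed (suc zero) (suc zero) = entry (suc zero) (suc zero)

  scalar-conjugate-νFixed : ∀ g h → (g *M2 h) ≈M2 I2 →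
    ∀ t i j → νF (((g *M2 diag2 (ofK t) (ofK t)) *M2 h) i j) ≈F ((g *M2 diag2 (ofK t) (ofK t)) *M2 h) i j
  scalar-conjugate-νFixed g h gh≈I t i j = begin
    νF (Y i j)            ≈⟨ νF-cong (Y≈tI i j) ⟩
    νF (ofK t *F I2 i j)  ≈⟨ scalarMatrix-νFixed t i j ⟩
    ofK t *F I2 i j       ≈⟨ Y≈tI i j ⟨
    Y i j                 ∎
    where
    open import Relation.Binary.Reasoning.Setoid F-setoid
    Y : M2
    Y = (g *M2 diag2 (ofK t) (ofK t)) *M2 h
    Y≈tI : ∀ i j → Y i j ≈F (ofK t *F I2 i j)
    Y≈tI i j = ≈F.trans (diag2-central t g h i j) (*F-cong ≈F.refl (gh≈I i j))

lemma3p19 : ∀ {a ℓ b ℓ′ : Level} (k : Field a ℓ) (A : KAlgebra k b ℓ′) →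
    IsQuaternionAlgebra A →
    (s p : Field.Carrier k) →
    -- x² - s x + p is irreducible over k (so F = k(α) is a quadratic field)
    (∀ c → ¬ (Field._≈_ k (Field._+_ k (Field._*_ k c c) (Field._+_ k (Field.-_ k (Field._*_ k s c)) p)) (Field.0# k))) →
    -- F/k is separable: α ≠ α^ν
    ¬ (Setup._≈F_ A s p (Setup.α A s p) (Setup.αν A s p)) →
    -- δ = 1/(α - α^ν)
    (δ : Setup.F A s p) →
    Setup._≈F_ A s p (Setup._*F_ A s p δ (Setup._+F_ A s p (Setup.α A s p) (Setup.-F_ A s p (Setup.αν A s p)))) (Setup.1F A s p) →
    -- h₁ , h₂ : the inverse g_α⁻¹ in G(F)
    (h₁ : Setup.M3 A s p) → (h₂ : Setup.M2 A s p) →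
    Setup._≈M3_ A s p (Setup._*M3_ A s p (Setup.gα₁ A s p) h₁) (Setup.I3 A s p) →
    Setup._≈M3_ A s p (Setup._*M3_ A s p h₁ (Setup.gα₁ A s p)) (Setup.I3 A s p) →
    Setup._≈M2_ A s p (Setup._*M2_ A s p (Setup.gα₂ A s p δ) h₂) (Setup.I2 A s p) →
    Setup._≈M2_ A s p (Setup._*M2_ A s p h₂ (Setup.gα₂ A s p δ)) (Setup.I2 A s p) →
    (b₁ : KAlgebra.Carrier A) → Setup.IsUnitB A s p b₁ →
    (b₂ : Setup.BF A s p) → Setup.IsUnitBF A s p b₂ →
    (t : Field.Carrier k) → ¬ (Field._≈_ k t (Field.0# k)) →
    Setup.InGk A s p
      ( Setup._*M3_ A s p (Setup._*M3_ A s p (Setup.gα₁ A s p)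
            (Setup.diag3 A s p (Setup.ofB A s p b₁) b₂ (Setup.νBF A s p b₂))) h₁
      , Setup._*M2_ A s p (Setup._*M2_ A s p (Setup.gα₂ A s p δ)
            (Setup.diag2 A s p (Setup.ofK A s p t) (Setup.ofK A s p t))) h₂ )
lemma3p19 k A _ s p _ _ δ δ-inv h₁ h₂ gα₁h₁≈I _ gα₂h₂≈I _ b₁ _ b₂ _ t _ =
  gα₁-conjugate-νFixed δ δ-inv h₁ gα₁h₁≈I b₁ b₂ ,
  scalar-conjugate-νFixed (Setup.gα₂ A s p δ) h₂ gα₂h₂≈I t
  where open GαConjugation A s p
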